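{- Fix a positive integer $n$. Let $u:2^{[n]} \rightarrow \mathbb{R}_{\geq 0}$ be a submodular and second-order supermodular set function and let $c:2^{[n]} \rightarrow \mathbb{R}_{\geq 0}$ be a modular set function. If the local search algorithm converges before terminating, then the solution it returns is a $4$-approximation to Min-Sum Submodular Cover on $u$ and $c$.
   Context: Min-Sum Submodular Cover: given a monotone submodular $u:2^{[n]}\to\mathbb{R}_{\ge 0}$ (assumed normalized, $u(\emptyset)=0$) and positive costs $c_1,\dots,c_n$ with $c(S)=\sum_{i\in S}c_i$, find a permutation of $[n]$ minimizing $\sum_{i=1}^n c(S_i)(u(S_i)-u(S_{i-1}))$, where $S_i$ is the set of the first $i$ elements of the permutation. Writing $f(e|S)=f(S\cup\{e\})-f(S)$, $u$ is submodular if $u(i|S)\ge u(i|S\cup\{j\})$, and second-order supermodular if $u(i|S)-u(i|S\cup\{j\}) \ge u(i|S\cup\{k\})-u(i|S\cup\{k,j\})$, for all $S\subseteq[n]$ and $i,j,k\in[n]\setminus S$. The local search algorithm takes $\epsilon>0$ and an initial $d$-approximate permutation $\pi$, and for up to $2n^3\log(d/\epsilon)$ iterations: among all neighbors of $\pi$ (permutations obtained by removing the element in some position $i$ and reinserting it in some position $j$) it finds one with lowest objective value; if that value is lower than the objective of $\pi$ it replaces $\pi$ by it, otherwise ("converges") it returns $\pi$ (a local optimum with respect to moves). If the iteration limit is reached it returns the current $\pi$.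
   Formalization: The set functions u and c are rational-valued rather than real-valued. -}

module Defs where

open import Data.Bool using (Bool; true; false; if_then_else_)
open import Data.Nat using (ℕ; zero; suc)
open import Data.Fin using (Fin)
open import Data.Fin.Subset using (Subset; ⁅_⁆; _∪_; _∉_; _⊆_) renaming (⊥ to ∅)
open import Data.List using (List; []; _∷_; allFin; foldr; map; lookup; insertAt; removeAt)
open import Data.List.Relation.Binary.Permutation.Propositional using (_↭_)
open import Data.Vec as Vec using ()
open import Data.Rational using (ℚ; 0ℚ; _+_; _*_; _-_; _≤_; _<_)
open import Data.Integer using (+_)
open import Relation.Binary.PropositionalEquality using (_≡_)

4ℚ : ℚ
4ℚ = Data.Rational._/_ (+ 4) 1

SetFn : ℕ → Set
SetFn n = Subset n → ℚ

marg : ∀ {n} → SetFn n → Fin n → Subset n → ℚ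
marg f e S = f (S ∪ ⁅ e ⁆) - f S

Normalized : ∀ {n} → SetFn n → Set
Normalized u = u ∅ ≡ 0ℚ

NonNegative : ∀ {n} → SetFn n → Set
NonNegative u = ∀ S → 0ℚ ≤ u S

Monotone : ∀ {n} → SetFn n → Set
Monotone u = ∀ S T → S ⊆ T → u S ≤ u T

Submodular : ∀ {n} → SetFn n → Set
Submodular u = ∀ S i j → i ∉ S → j ∉ S →
  marg u i (S ∪ ⁅ j ⁆) ≤ marg u i S

SecondOrderSupermodular : ∀ {n} → SetFn n → Set
SecondOrderSupermodular u = ∀ S i j k → i ∉ S → j ∉ S → k ∉ S →
  marg u i (S ∪ ⁅ k ⁆) - marg u i ((S ∪ ⁅ k ⁆) ∪ ⁅ j ⁆)
    ≤ marg u i S - marg u i (S ∪ ⁅ j ⁆)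

-- positive per-element costs; c(S) = Σ_{i ∈ S} c_i (modular)
PositiveCosts : ∀ {n} → (Fin n → ℚ) → Set
PositiveCosts c = ∀ i → 0ℚ < c i

costOf : ∀ {n} → (Fin n → ℚ) → Subset n → ℚ
costOf {n} c S = foldr _+_ 0ℚ (map (λ i → if Vec.lookup S i then c i else 0ℚ) (allFin n))

-- An ordering (permutation of [n]) is a list of the elements of Fin n
-- which is a permutation of allFin n; position k holds the k-th element.
IsPermutation : ∀ {n} → List (Fin n) → Set
IsPermutation {n} xs = xs ↭ allFin n

-- Σ_i c(S_i)(u(S_i) − u(S_{i−1})) starting from prefix set S
objFrom : ∀ {n} → SetFn n → (Fin n → ℚ) → Subset n → List (Fin n) → ℚ
objFrom u c S []       = 0ℚ
objFrom u c S (x ∷ xs) =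
  costOf c (S ∪ ⁅ x ⁆) * (u (S ∪ ⁅ x ⁆) - u S) + objFrom u c (S ∪ ⁅ x ⁆) xs

objective : ∀ {n} → SetFn n → (Fin n → ℚ) → List (Fin n) → ℚ
objective u c xs = objFrom u c ∅ xs

move : ∀ {n} (xs : List (Fin n)) (i : Fin (Data.List.length xs)) →
       Fin (suc (Data.List.length (removeAt xs i))) → List (Fin n)
move xs i j = insertAt (removeAt xs i) j (lookup xs i)

-- The local search converges at π: no neighbor has strictly lower objective,
-- i.e. the best neighbor's objective is not lower than π's.
LocalOptimum : ∀ {n} → SetFn n → (Fin n → ℚ) → List (Fin n) → Set
LocalOptimum u c xs = ∀ i j → objective u c xs ≤ objective u c (move xs i j)

{-# OPTIONS --safe #-}
module Submission where

-- Let π be the local optimum and σ any ordering.  For a step p of an ordering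
-- write S_p for the set covered before it, x_p for the item it adds, c(p) for
-- the cost of S_p ∪ {x_p} and Δ_p for its gain, so that ALG = Σ_p c(p) Δ_p.
-- Call a step q of σ cheap for a step p of π when 2c(q) ≤ c(p).
-- By Abel summation ALG = Σ_p c(x_p) (u([n]) − u(S_p)), and walking along σ,
-- submodularity bounds u([n]) − u(S_p) by the marginals u(x_q | S_p) of the
-- steps q cheap for p plus the gains Δ_q of the other steps.  The second part
-- is at most 2·OPT: the items of π whose prefix cost is below 2c(q) form a
-- prefix of π, so their prices add up to at most 2c(q).  For the first part,
-- local optimality (moving an item in front of a segment never helps) bounds
-- the price-weighted marginals of x_q over the steps of π with c(p) ≥ 2c(q),
-- a suffix of π, by c(x_q) times the gain of that suffix; after exchanging the
-- sums, the cheap items of σ for p again form a prefix, of price at most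
-- c(p)/2, so the first part is at most ALG/2.  Hence ALG ≤ ALG/2 + 2·OPT.

open import Defs
open import Data.Nat using (ℕ; NonZero)
open import Data.Fin using (Fin)
open import Data.List using (List)
open import Data.Rational using (ℚ; _≤_; _*_)

open import Algebra using (CommutativeMonoid)
open import Data.Bool using (true; false; if_then_else_; _∨_)
open import Data.Bool.Properties using (∨-identityʳ)
open import Data.Fin using (zero; suc)
open import Data.Fin.Subset using (Subset; ⁅_⁆; _∪_; _∈_; _∉_; _⊆_; ⊤) renaming (⊥ to ∅)
open import Data.Fin.Subset.Properties
  using (_∈?_; x∈⁅x⁆; x∈⁅y⁆⇒x≡y; x∈p∪q⁻; x∈p∪q⁺; p⊆p∪q; q⊆p∪q; ⊆-antisym; ⊆-min; ⊆-max; ∉⊥;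
         ∪-assoc; ∪-comm; ∪-identityˡ; ∪-identityʳ)
open import Data.List using ([]; _∷_; _++_; [_]; lookup; insertAt; removeAt; foldr)
open import Data.List.Properties using (++-assoc; map-tabulate)
open import Data.List.Membership.Propositional using () renaming (_∈_ to _∈ₗ_)
open import Data.List.Membership.Propositional.Properties using (∈-allFin; ∈-++⁻; ∈-∃++)
open import Data.List.Relation.Unary.All as All using (All; []; _∷_)
open import Data.List.Relation.Unary.Any using (here; there)
open import Data.List.Relation.Unary.Unique.Propositional using (Unique; []; _∷_)
open import Data.List.Relation.Unary.Unique.Propositional.Properties using (allFin⁺)
open import Data.List.Relation.Binary.Permutation.Propositional using (↭-sym; ↭⇒↭ₛ)
open import Data.List.Relation.Binary.Permutation.Propositional.Properties using (∈-resp-↭)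
import Data.List.Relation.Binary.Permutation.Setoid.Properties as ↭ₛ
import Data.Nat as ℕ
open import Data.Product as Product using (_×_; _,_; ∃₂; ∃-syntax)
open import Data.Rational using (0ℚ; _+_; _-_; -_; _≥_; _≤?_; nonNegative)
import Data.Rational.Properties as ℚ
open import Data.Rational.Solver using (module +-*-Solver)
open import Data.Sum using (inj₁; inj₂; [_,_]′; map₁)
open import Data.Unit using (tt) renaming (⊤ to Unit)
open import Data.Vec using ([]; _∷_; here; there)
open import Function using (_∘_; id; flip)
open import Relation.Binary using (_Respects_)
open import Relation.Binary.PropositionalEquality
  using (_≡_; _≢_; refl; sym; trans; cong; cong₂; subst; subst₂; setoid; module ≡-Reasoning)
open import Relation.Nullary using (Dec; yes; no; ¬_; ¬?; contradiction)
open import Relation.Unary using (Decidable)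

open import Algebra.Properties.CommutativeSemigroup
  (CommutativeMonoid.commutativeSemigroup ℚ.+-0-commutativeMonoid) using (interchange)
open +-*-Solver using (solve; _:+_; _:*_; _:-_; :-_; _:=_; con)

private
  variable
    A B : Set
    n : ℕ

-- Sums and indicators

∑ : List A → (A → ℚ) → ℚ
∑ []       f = 0ℚ
∑ (x ∷ xs) f = f x + ∑ xs f

syntax ∑ xs (λ x → t) = ∑[ x ← xs ] t

∑-cong : ∀ (xs : List A) {f g : A → ℚ} → (∀ x → f x ≡ g x) → ∑ xs f ≡ ∑ xs g
∑-cong []       f≡g = refl
∑-cong (x ∷ xs) f≡g = cong₂ _+_ (f≡g x) (∑-cong xs f≡g)

∑-mono-≤ : ∀ (xs : List A) {f g : A → ℚ} → (∀ x → f x ≤ g x) → ∑ xs f ≤ ∑ xs g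
∑-mono-≤ []       f≤g = ℚ.≤-refl
∑-mono-≤ (x ∷ xs) f≤g = ℚ.+-mono-≤ (f≤g x) (∑-mono-≤ xs f≤g)

∑-zero : ∀ (xs : List A) → ∑ xs (λ _ → 0ℚ) ≡ 0ℚ
∑-zero []       = refl
∑-zero (x ∷ xs) = trans (ℚ.+-identityˡ _) (∑-zero xs)

∑-++ : ∀ (xs ys : List A) (f : A → ℚ) → ∑ (xs ++ ys) f ≡ ∑ xs f + ∑ ys f
∑-++ []       ys f = sym (ℚ.+-identityˡ _)
∑-++ (x ∷ xs) ys f = trans (cong (f x +_) (∑-++ xs ys f)) (sym (ℚ.+-assoc (f x) _ _))

∑-distrib-+ : ∀ (xs : List A) (f g : A → ℚ) → ∑[ x ← xs ] (f x + g x) ≡ ∑ xs f + ∑ xs g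
∑-distrib-+ []       f g = refl
∑-distrib-+ (x ∷ xs) f g =
  trans (cong (f x + g x +_) (∑-distrib-+ xs f g)) (interchange (f x) (g x) (∑ xs f) (∑ xs g))

*-distribˡ-∑ : ∀ k (xs : List A) (f : A → ℚ) → k * ∑ xs f ≡ ∑[ x ← xs ] (k * f x)
*-distribˡ-∑ k []       f = ℚ.*-zeroʳ k
*-distribˡ-∑ k (x ∷ xs) f =
  trans (ℚ.*-distribˡ-+ k (f x) (∑ xs f)) (cong (k * f x +_) (*-distribˡ-∑ k xs f))

∑-comm : ∀ (xs : List A) (ys : List B) (F : A → B → ℚ) →
  ∑[ x ← xs ] ∑[ y ← ys ] F x y ≡ ∑[ y ← ys ] ∑[ x ← xs ] F x y
∑-comm []       ys F = sym (∑-zero ys)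
∑-comm (x ∷ xs) ys F =
  trans (cong (∑ ys (F x) +_) (∑-comm xs ys F)) (sym (∑-distrib-+ ys (F x) λ y → ∑[ x′ ← xs ] F x′ y))

when : {P : Set} → Dec P → ℚ → ℚ
when (yes _) q = q
when (no _)  q = 0ℚ

*-when : ∀ {P : Set} k (P? : Dec P) q → k * when P? q ≡ when P? (k * q)
*-when k (yes _) q = refl
*-when k (no _)  q = ℚ.*-zeroʳ k

module _ {P : A → Set} (P? : Decidable P) (f : A → ℚ) where

  ∑-when-all : ∀ {xs} → All P xs → ∑[ x ← xs ] when (P? x) (f x) ≡ ∑ xs f
  ∑-when-all []               = refl
  ∑-when-all (_∷_ {x} px pxs) with P? x
  ... | yes _  = cong (f x +_) (∑-when-all pxs)
  ... | no ¬px = contradiction px ¬px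

  ∑-when-none : ∀ {xs} → All (¬_ ∘ P) xs → ∑[ x ← xs ] when (P? x) (f x) ≡ 0ℚ
  ∑-when-none []                 = refl
  ∑-when-none (_∷_ {x} ¬px ¬pxs) with P? x
  ... | yes px = contradiction px ¬px
  ... | no _   = trans (ℚ.+-identityˡ _) (∑-when-none ¬pxs)

*-∑-when : ∀ {P : A → Set} k (xs : List A) (P? : Decidable P) (f : A → ℚ) →
  k * ∑[ x ← xs ] when (P? x) (f x) ≡ ∑[ x ← xs ] when (P? x) (k * f x)
*-∑-when k xs P? f = trans (*-distribˡ-∑ k xs _) (∑-cong xs λ x → *-when k (P? x) (f x))

module _ {R : A → B → Set} (R? : ∀ x y → Dec (R x y)) (xs : List A) (ys : List B) where

  ∑-*-∑-when : ∀ (f : A → ℚ) (h : A → B → ℚ) →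
    ∑[ x ← xs ] (f x * ∑[ y ← ys ] when (R? x y) (h x y))
      ≡ ∑[ y ← ys ] ∑[ x ← xs ] when (R? x y) (f x * h x y)
  ∑-*-∑-when f h = trans (∑-cong xs λ x → *-∑-when (f x) ys (R? x) (h x)) (∑-comm xs ys _)

  ∑-*-∑-when-comm : ∀ (f : A → ℚ) (g : B → ℚ) →
    ∑[ x ← xs ] (f x * ∑[ y ← ys ] when (R? x y) (g y))
      ≡ ∑[ y ← ys ] (g y * ∑[ x ← xs ] when (R? x y) (f x))
  ∑-*-∑-when-comm f g = begin
    ∑[ x ← xs ] (f x * ∑[ y ← ys ] when (R? x y) (g y))
      ≡⟨ ∑-*-∑-when f (λ _ → g) ⟩
    ∑[ y ← ys ] ∑[ x ← xs ] when (R? x y) (f x * g y)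
      ≡⟨ ∑-cong ys (λ y → ∑-cong xs λ x → cong (when (R? x y)) (ℚ.*-comm (f x) (g y))) ⟩
    ∑[ y ← ys ] ∑[ x ← xs ] when (R? x y) (g y * f x)
      ≡⟨ ∑-cong ys (λ y → sym (*-∑-when (g y) xs (flip R? y) f)) ⟩
    ∑[ y ← ys ] (g y * ∑[ x ← xs ] when (R? x y) (f x))
      ∎
    where open ≡-Reasoning

module _ {p q : ℚ} where

  p≤q⇒0≤q-p : p ≤ q → 0ℚ ≤ q - p
  p≤q⇒0≤q-p p≤q = ℚ.≤-trans (ℚ.≤-reflexive (sym (ℚ.+-inverseʳ p))) (ℚ.+-monoˡ-≤ (- p) p≤q)

  p≤q⇒p-q≤0 : p ≤ q → p - q ≤ 0ℚ
  p≤q⇒p-q≤0 p≤q = ℚ.≤-trans (ℚ.+-monoˡ-≤ (- q) p≤q) (ℚ.≤-reflexive (ℚ.+-inverseʳ q))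

  +-cancelˡ-≤ : ∀ r → r + p ≤ r + q → p ≤ q
  +-cancelˡ-≤ r r+p≤r+q = begin
    p              ≡⟨ cancel p ⟩
    - r + (r + p)  ≤⟨ ℚ.+-monoʳ-≤ (- r) r+p≤r+q ⟩
    - r + (r + q)  ≡⟨ sym (cancel q) ⟩
    q              ∎
    where
    open ℚ.≤-Reasoning
    cancel : ∀ s → s ≡ - r + (r + s)
    cancel = solve 2 (λ r s → s := :- r :+ (r :+ s)) refl r

  +-cancelʳ-≤ : ∀ r → p + r ≤ q + r → p ≤ q
  +-cancelʳ-≤ r p+r≤q+r = +-cancelˡ-≤ r (subst₂ _≤_ (ℚ.+-comm p r) (ℚ.+-comm q r) p+r≤q+r)

*-monoˡ-≤-0≤ : ∀ {r p q} → 0ℚ ≤ r → p ≤ q → r * p ≤ r * q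
*-monoˡ-≤-0≤ {r} 0≤r = ℚ.*-monoˡ-≤-nonNeg r {{nonNegative 0≤r}}

double-≤-respects-≥ : ∀ t → (λ x → x + x ≤ t) Respects _≥_
double-≤-respects-≥ t y≤x x+x≤t = ℚ.≤-trans (ℚ.+-mono-≤ y≤x y≤x) x+x≤t

≰-respects-≥ : ∀ t → (λ x → ¬ t ≤ x) Respects _≥_
≰-respects-≥ t y≤x t≰x t≤y = t≰x (ℚ.≤-trans t≤y y≤x)

difference-telescope : ∀ a b d → (b - a) + (d - b) ≡ d - a
difference-telescope = solve 3 (λ a b d → (b :- a) :+ (d :- b) := d :- a) refl

a≤b+c⇒b+b≤a⇒c≤d+d⇒a≤4d : ∀ {a b c d} → a ≤ b + c → b + b ≤ a → c ≤ d + d → a ≤ 4ℚ * d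
a≤b+c⇒b+b≤a⇒c≤d+d⇒a≤4d {a} {b} {c} {d} a≤b+c b+b≤a c≤d+d = +-cancelˡ-≤ a (begin
  a + a                    ≤⟨ ℚ.+-mono-≤ a≤b+c a≤b+c ⟩
  (b + c) + (b + c)        ≡⟨ interchange b c b c ⟩
  (b + b) + (c + c)        ≤⟨ ℚ.+-mono-≤ b+b≤a (ℚ.+-mono-≤ c≤d+d c≤d+d) ⟩
  a + ((d + d) + (d + d))  ≡⟨ cong (a +_) (solve 1 (λ d → (d :+ d) :+ (d :+ d) := con 4ℚ :* d) refl d) ⟩
  a + 4ℚ * d               ∎)
  where open ℚ.≤-Reasoning

-- Subsets, costs and marginals

module _ {S : Subset n} where

  ∪⁅⁆-absorb : ∀ {x} → x ∈ S → S ∪ ⁅ x ⁆ ≡ S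
  ∪⁅⁆-absorb {x} x∈S = ⊆-antisym (λ y∈ → [ id , x∈S′ ]′ (x∈p∪q⁻ S ⁅ x ⁆ y∈)) (p⊆p∪q ⁅ x ⁆)
    where
    x∈S′ : ∀ {y} → y ∈ ⁅ x ⁆ → y ∈ S
    x∈S′ y∈⁅x⁆ = subst (_∈ S) (sym (x∈⁅y⁆⇒x≡y x y∈⁅x⁆)) x∈S

  ∪⁅⁆-swap : ∀ x y → (S ∪ ⁅ x ⁆) ∪ ⁅ y ⁆ ≡ (S ∪ ⁅ y ⁆) ∪ ⁅ x ⁆
  ∪⁅⁆-swap x y = trans (∪-assoc S ⁅ x ⁆ ⁅ y ⁆)
    (trans (cong (S ∪_) (∪-comm ⁅ x ⁆ ⁅ y ⁆)) (sym (∪-assoc S ⁅ y ⁆ ⁅ x ⁆)))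

  ∪⁅⁆-mono : ∀ {T : Subset n} x → S ⊆ T → S ∪ ⁅ x ⁆ ⊆ T ∪ ⁅ x ⁆
  ∪⁅⁆-mono x S⊆T y∈ = x∈p∪q⁺ (map₁ S⊆T (x∈p∪q⁻ S ⁅ x ⁆ y∈))

costOf-∷ : ∀ (c : Fin (ℕ.suc n) → ℚ) b S →
  costOf c (b ∷ S) ≡ (if b then c zero else 0ℚ) + costOf (c ∘ suc) S
costOf-∷ c b S = cong ((if b then c zero else 0ℚ) +_)
  (cong (foldr _+_ 0ℚ) (trans (map-tabulate suc term) (sym (map-tabulate id (term ∘ suc)))))
  where term = λ i → if Data.Vec.lookup (b ∷ S) i then c i else 0ℚ

costOf-∅ : ∀ (c : Fin n → ℚ) → costOf c ∅ ≡ 0ℚ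
costOf-∅ {ℕ.zero}  c = refl
costOf-∅ {ℕ.suc n} c = trans (costOf-∷ c false ∅) (trans (ℚ.+-identityˡ _) (costOf-∅ (c ∘ suc)))

costOf-∪⁅⁆ : ∀ (c : Fin n → ℚ) {S x} → x ∉ S → costOf c (S ∪ ⁅ x ⁆) ≡ costOf c S + c x
costOf-∪⁅⁆ c {true ∷ S}  {zero}  x∉S = contradiction here x∉S
costOf-∪⁅⁆ c {false ∷ S} {zero}  _   = begin
  costOf c (true ∷ (S ∪ ∅))            ≡⟨ costOf-∷ c true (S ∪ ∅) ⟩
  c zero + costOf (c ∘ suc) (S ∪ ∅)    ≡⟨ cong (λ T → c zero + costOf (c ∘ suc) T) (∪-identityʳ S) ⟩
  c zero + costOf (c ∘ suc) S          ≡⟨ ℚ.+-comm (c zero) _ ⟩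
  costOf (c ∘ suc) S + c zero          ≡⟨ cong (_+ c zero) (sym (ℚ.+-identityˡ (costOf (c ∘ suc) S))) ⟩
  (0ℚ + costOf (c ∘ suc) S) + c zero   ≡⟨ cong (_+ c zero) (sym (costOf-∷ c false S)) ⟩
  costOf c (false ∷ S) + c zero        ∎
  where open ≡-Reasoning
costOf-∪⁅⁆ c {b ∷ S}     {suc x} x∉S = begin
  costOf c ((b ∨ false) ∷ (S ∪ ⁅ x ⁆))   ≡⟨ cong (λ b′ → costOf c (b′ ∷ (S ∪ ⁅ x ⁆))) (∨-identityʳ b) ⟩
  costOf c (b ∷ (S ∪ ⁅ x ⁆))             ≡⟨ costOf-∷ c b (S ∪ ⁅ x ⁆) ⟩
  c₀ + costOf (c ∘ suc) (S ∪ ⁅ x ⁆)      ≡⟨ cong (c₀ +_) (costOf-∪⁅⁆ (c ∘ suc) (x∉S ∘ there)) ⟩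
  c₀ + (costOf (c ∘ suc) S + c (suc x))  ≡⟨ sym (ℚ.+-assoc c₀ _ _) ⟩
  (c₀ + costOf (c ∘ suc) S) + c (suc x)  ≡⟨ cong (_+ c (suc x)) (sym (costOf-∷ c b S)) ⟩
  costOf c (b ∷ S) + c (suc x)           ∎
  where
  open ≡-Reasoning
  c₀ = if b then c zero else 0ℚ

costOf-∪-≥ : ∀ {c : Fin n → ℚ} → (∀ i → 0ℚ ≤ c i) → ∀ S T → costOf c S ≤ costOf c (S ∪ T)
costOf-∪-≥         c≥0 []      []       = ℚ.≤-refl
costOf-∪-≥ {c = c} c≥0 (b ∷ S) (b′ ∷ T) = begin
  costOf c (b ∷ S)
    ≡⟨ costOf-∷ c b S ⟩
  (if b then c zero else 0ℚ) + costOf (c ∘ suc) S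
    ≤⟨ ℚ.+-mono-≤ (if-∨-≥ b b′) (costOf-∪-≥ (c≥0 ∘ suc) S T) ⟩
  (if b ∨ b′ then c zero else 0ℚ) + costOf (c ∘ suc) (S ∪ T)
    ≡⟨ sym (costOf-∷ c (b ∨ b′) (S ∪ T)) ⟩
  costOf c ((b ∨ b′) ∷ (S ∪ T))
    ∎
  where
  open ℚ.≤-Reasoning
  if-∨-≥ : ∀ b b′ → (if b then c zero else 0ℚ) ≤ (if b ∨ b′ then c zero else 0ℚ)
  if-∨-≥ true  _     = ℚ.≤-refl
  if-∨-≥ false true  = c≥0 zero
  if-∨-≥ false false = ℚ.≤-refl

module _ (u : SetFn n) where

  marg-∈ : ∀ {e S} → e ∈ S → marg u e S ≡ 0ℚ
  marg-∈ {e} {S} e∈S = trans (cong (λ T → u T - u S) (∪⁅⁆-absorb e∈S)) (ℚ.+-inverseʳ (u S))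

  Submodular⇒marg-∪⁅⁆-≤ : Submodular u → ∀ S i j → marg u i (S ∪ ⁅ j ⁆) ≤ marg u i S
  Submodular⇒marg-∪⁅⁆-≤ sub S i j with i ∈? S | j ∈? S
  ... | yes i∈S | _       = ℚ.≤-reflexive (trans (marg-∈ (p⊆p∪q ⁅ j ⁆ i∈S)) (sym (marg-∈ i∈S)))
  ... | no _    | yes j∈S rewrite ∪⁅⁆-absorb j∈S = ℚ.≤-refl
  ... | no i∉S  | no j∉S  = sub S i j i∉S j∉S

-- Orderings as sequences of steps

record Step (n : ℕ) : Set where
  constructor step
  field
    before : Subset n
    item   : Fin n

open Step public

after : Step n → Subset n
after p = before p ∪ ⁅ item p ⁆

covered : Subset n → List (Fin n) → Subset n
covered S []       = S
covered S (x ∷ xs) = covered (S ∪ ⁅ x ⁆) xs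

steps : Subset n → List (Fin n) → List (Step n)
steps S []       = []
steps S (x ∷ xs) = step S x ∷ steps (S ∪ ⁅ x ⁆) xs

Fresh : Subset n → List (Fin n) → Set
Fresh S []       = Unit
Fresh S (x ∷ xs) = x ∉ S × Fresh (S ∪ ⁅ x ⁆) xs

covered-++ : ∀ (S : Subset n) xs ys → covered S (xs ++ ys) ≡ covered (covered S xs) ys
covered-++ S []       ys = refl
covered-++ S (x ∷ xs) ys = covered-++ (S ∪ ⁅ x ⁆) xs ys

covered-∪⁅⁆ : ∀ (S : Subset n) x xs → covered (S ∪ ⁅ x ⁆) xs ≡ covered S xs ∪ ⁅ x ⁆
covered-∪⁅⁆ S x []       = refl
covered-∪⁅⁆ S x (y ∷ xs) =
  trans (cong (λ T → covered T xs) (∪⁅⁆-swap x y)) (covered-∪⁅⁆ (S ∪ ⁅ y ⁆) x xs)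

⊆-covered : ∀ (S : Subset n) xs → S ⊆ covered S xs
⊆-covered S []       = id
⊆-covered S (x ∷ xs) = ⊆-covered (S ∪ ⁅ x ⁆) xs ∘ p⊆p∪q ⁅ x ⁆

∈-covered : ∀ (S : Subset n) {xs y} → y ∈ₗ xs → y ∈ covered S xs
∈-covered S {x ∷ xs} (here refl) = ⊆-covered (S ∪ ⁅ x ⁆) xs (q⊆p∪q S ⁅ x ⁆ (x∈⁅x⁆ x))
∈-covered S {x ∷ xs} (there y∈)  = ∈-covered (S ∪ ⁅ x ⁆) y∈

covered-⊤ : ∀ {xs : List (Fin n)} → (∀ e → e ∈ₗ xs) → covered ∅ xs ≡ ⊤
covered-⊤ covers = ⊆-antisym (⊆-max _) (λ {e} _ → ∈-covered ∅ (covers e))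

steps-++ : ∀ (S : Subset n) xs ys → steps S (xs ++ ys) ≡ steps S xs ++ steps (covered S xs) ys
steps-++ S []       ys = refl
steps-++ S (x ∷ xs) ys = cong (step S x ∷_) (steps-++ (S ∪ ⁅ x ⁆) xs ys)

∑-steps-++ : ∀ (S : Subset n) xs ys (f : Step n → ℚ) →
  ∑ (steps S (xs ++ ys)) f ≡ ∑ (steps S xs) f + ∑ (steps (covered S xs) ys) f
∑-steps-++ S xs ys f = trans (cong (λ ps → ∑ ps f) (steps-++ S xs ys)) (∑-++ (steps S xs) _ f)

Fresh-++⁻ : ∀ (S : Subset n) xs {ys} → Fresh S (xs ++ ys) → Fresh S xs × Fresh (covered S xs) ys
Fresh-++⁻ S []       fresh         = tt , fresh
Fresh-++⁻ S (x ∷ xs) (x∉S , fresh) = Product.map₁ (x∉S ,_) (Fresh-++⁻ (S ∪ ⁅ x ⁆) xs fresh)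

Unique⇒Fresh : ∀ {S : Subset n} {xs} → Unique xs → All (_∉ S) xs → Fresh S xs
Unique⇒Fresh         []                      []           = tt
Unique⇒Fresh {S = S} (_∷_ {x} x≢xs unique) (x∉S ∷ xs∉S) =
  x∉S , Unique⇒Fresh unique (All.zipWith ∉S∪⁅x⁆ (x≢xs , xs∉S))
  where
  ∉S∪⁅x⁆ : ∀ {y} → x ≢ y × y ∉ S → y ∉ S ∪ ⁅ x ⁆
  ∉S∪⁅x⁆ (x≢y , y∉S) y∈ =
    [ y∉S , (λ y∈⁅x⁆ → x≢y (sym (x∈⁅y⁆⇒x≡y x y∈⁅x⁆))) ]′ (x∈p∪q⁻ S ⁅ x ⁆ y∈)

IsPermutation⇒Fresh : ∀ {xs : List (Fin n)} → IsPermutation xs → Fresh ∅ xs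
IsPermutation⇒Fresh {n} xs↭ = Unique⇒Fresh
  (↭ₛ.Unique-resp-↭ (setoid (Fin n)) (↭⇒↭ₛ (↭-sym xs↭)) (allFin⁺ n)) (All.universal (λ _ → ∉⊥) _)

IsPermutation⇒∈ : ∀ {xs : List (Fin n)} → IsPermutation xs → ∀ e → e ∈ₗ xs
IsPermutation⇒∈ xs↭ e = ∈-resp-↭ (↭-sym xs↭) (∈-allFin e)

removeAt-middle : ∀ (xs : List A) P x Q → xs ≡ P ++ x ∷ Q →
  ∃[ i ] (removeAt xs i ≡ P ++ Q × lookup xs i ≡ x)
removeAt-middle _ []      x Q refl = zero , refl , refl
removeAt-middle _ (y ∷ P) x Q refl =
  Product.map suc (Product.map₁ (cong (y ∷_))) (removeAt-middle (P ++ x ∷ Q) P x Q refl)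

insertAt-middle : ∀ (ys : List A) P Q x → ys ≡ P ++ Q → ∃[ j ] insertAt ys j x ≡ P ++ x ∷ Q
insertAt-middle _ []      Q x refl = zero , refl
insertAt-middle _ (y ∷ P) Q x refl = Product.map suc (cong (y ∷_)) (insertAt-middle (P ++ Q) P Q x refl)

move-earlier : ∀ (P W : List (Fin n)) e Q →
  ∃₂ λ i j → move (P ++ (W ++ [ e ]) ++ Q) i j ≡ P ++ (e ∷ W) ++ Q
move-earlier P W e Q =
  let i , removed , found = removeAt-middle xs (P ++ W) e Q xs≡
      j , inserted        = insertAt-middle (removeAt xs i) P (W ++ Q) e (trans removed (++-assoc P W Q))
  in  i , j , trans (cong (insertAt (removeAt xs i) j) found) inserted
  where
  xs = P ++ (W ++ [ e ]) ++ Q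
  xs≡ : xs ≡ (P ++ W) ++ e ∷ Q
  xs≡ = trans (cong (P ++_) (++-assoc W [ e ] Q)) (sym (++-assoc P W (e ∷ Q)))

-- The objective

private
  -- The induction step of objFrom-move-to-front for W = w ∷ _, where Cₑ, C₀
  -- and C₀ₑ are the costs of S ∪ {e}, S ∪ {w} and S ∪ {w, e}.
  move-to-front-step : ∀ C cₑ c₀ a b d f O rest O′ U {Cₑ C₀ C₀ₑ} →
    Cₑ ≡ C + cₑ → C₀ ≡ C + c₀ → C₀ₑ ≡ C₀ + cₑ →
    (C₀ₑ * (f - d) + O) + rest ≡ O′ + cₑ * (U - d) →
    (Cₑ * (b - a) + (C₀ₑ * (f - b) + O)) + (c₀ * (b - a) + rest) ≡ (C₀ * (d - a) + O′) + cₑ * (U - a)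
  move-to-front-step C cₑ c₀ a b d f O rest O′ U refl refl refl ih = begin
    ((C + cₑ) * (b - a) + ((C + c₀ + cₑ) * (f - b) + O)) + (c₀ * (b - a) + rest)
      ≡⟨ solve 9 (λ C cₑ c₀ a b d f O rest →
           ((C :+ cₑ) :* (b :- a) :+ ((C :+ c₀ :+ cₑ) :* (f :- b) :+ O)) :+ (c₀ :* (b :- a) :+ rest)
           := (C :+ c₀) :* (d :- a) :+ (((C :+ c₀ :+ cₑ) :* (f :- d) :+ O) :+ rest) :+ cₑ :* (d :- a))
           refl C cₑ c₀ a b d f O rest ⟩
    (C + c₀) * (d - a) + (((C + c₀ + cₑ) * (f - d) + O) + rest) + cₑ * (d - a)
      ≡⟨ cong (λ z → (C + c₀) * (d - a) + z + cₑ * (d - a)) ih ⟩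
    (C + c₀) * (d - a) + (O′ + cₑ * (U - d)) + cₑ * (d - a)
      ≡⟨ solve 7 (λ C cₑ c₀ a d O′ U →
           (C :+ c₀) :* (d :- a) :+ (O′ :+ cₑ :* (U :- d)) :+ cₑ :* (d :- a)
           := ((C :+ c₀) :* (d :- a) :+ O′) :+ cₑ :* (U :- a))
           refl C cₑ c₀ a d O′ U ⟩
    ((C + c₀) * (d - a) + O′) + cₑ * (U - a)
      ∎
    where open ≡-Reasoning

module Objective (u : SetFn n) (c : Fin n → ℚ) where

  cost gain price : Step n → ℚ
  cost  p = costOf c (after p)
  gain  p = u (after p) - u (before p)
  price p = c (item p)

  objFrom≡∑ : ∀ S xs → objFrom u c S xs ≡ ∑[ p ← steps S xs ] (cost p * gain p)
  objFrom≡∑ S []       = refl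
  objFrom≡∑ S (x ∷ xs) = cong (cost (step S x) * gain (step S x) +_) (objFrom≡∑ (S ∪ ⁅ x ⁆) xs)

  objFrom-++ : ∀ S xs ys → objFrom u c S (xs ++ ys) ≡ objFrom u c S xs + objFrom u c (covered S xs) ys
  objFrom-++ S []       ys = sym (ℚ.+-identityˡ _)
  objFrom-++ S (x ∷ xs) ys =
    trans (cong (first +_) (objFrom-++ (S ∪ ⁅ x ⁆) xs ys)) (sym (ℚ.+-assoc first (objFrom u c (S ∪ ⁅ x ⁆) xs) _))
    where first = cost (step S x) * gain (step S x)

  objFrom-segment : ∀ S P X Q → objFrom u c S (P ++ X ++ Q)
    ≡ (objFrom u c S P + objFrom u c (covered S P) X) + objFrom u c (covered (covered S P) X) Q
  objFrom-segment S P X Q = trans (objFrom-++ S P (X ++ Q))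
    (trans (cong (objFrom u c S P +_) (objFrom-++ (covered S P) X Q)) (sym (ℚ.+-assoc (objFrom u c S P) _ _)))

  ∑-gain : ∀ S xs → ∑ (steps S xs) gain ≡ u (covered S xs) - u S
  ∑-gain S []       = sym (ℚ.+-inverseʳ (u S))
  ∑-gain S (x ∷ xs) = trans (cong (gain (step S x) +_) (∑-gain (S ∪ ⁅ x ⁆) xs))
                            (difference-telescope (u S) (u (S ∪ ⁅ x ⁆)) (u (covered S (x ∷ xs))))

  ∑-marg-∈ : ∀ {e S} xs → e ∈ S → ∑[ p ← steps S xs ] (price p * marg u e (before p)) ≡ 0ℚ
  ∑-marg-∈         []       e∈S = refl
  ∑-marg-∈ {e} {S} (x ∷ xs) e∈S = begin
    c x * marg u e S + ∑[ p ← steps (S ∪ ⁅ x ⁆) xs ] (price p * marg u e (before p))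
      ≡⟨ cong₂ _+_ (cong (c x *_) (marg-∈ u e∈S)) (∑-marg-∈ xs (p⊆p∪q ⁅ x ⁆ e∈S)) ⟩
    c x * 0ℚ + 0ℚ
      ≡⟨ trans (ℚ.+-identityʳ _) (ℚ.*-zeroʳ (c x)) ⟩
    0ℚ
      ∎
    where open ≡-Reasoning

  objFrom-abel : ∀ S xs → Fresh S xs →
    objFrom u c S xs ≡ costOf c S * (u (covered S xs) - u S)
                       + ∑[ p ← steps S xs ] (price p * (u (covered S xs) - u (before p)))
  objFrom-abel S []       _             =
    solve 2 (λ C a → con 0ℚ := C :* (a :- a) :+ con 0ℚ) refl (costOf c S) (u S)
  objFrom-abel S (x ∷ xs) (x∉S , fresh) = begin
    C′ * (u (S ∪ ⁅ x ⁆) - u S) + objFrom u c (S ∪ ⁅ x ⁆) xs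
      ≡⟨ cong (C′ * (u (S ∪ ⁅ x ⁆) - u S) +_) (objFrom-abel (S ∪ ⁅ x ⁆) xs fresh) ⟩
    C′ * (u (S ∪ ⁅ x ⁆) - u S) + (C′ * (U - u (S ∪ ⁅ x ⁆)) + rest)
      ≡⟨ cong (λ C → C * (u (S ∪ ⁅ x ⁆) - u S) + (C * (U - u (S ∪ ⁅ x ⁆)) + rest)) (costOf-∪⁅⁆ c x∉S) ⟩
    (costOf c S + c x) * (u (S ∪ ⁅ x ⁆) - u S) + ((costOf c S + c x) * (U - u (S ∪ ⁅ x ⁆)) + rest)
      ≡⟨ solve 6 (λ C k a b U rest → (C :+ k) :* (b :- a) :+ ((C :+ k) :* (U :- b) :+ rest)
                                      := C :* (U :- a) :+ (k :* (U :- a) :+ rest))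
               refl (costOf c S) (c x) (u S) (u (S ∪ ⁅ x ⁆)) U rest ⟩
    costOf c S * (U - u S) + (c x * (U - u S) + rest)
      ∎
    where
    open ≡-Reasoning
    C′   = costOf c (S ∪ ⁅ x ⁆)
    U    = u (covered (S ∪ ⁅ x ⁆) xs)
    rest = ∑[ p ← steps (S ∪ ⁅ x ⁆) xs ] (price p * (U - u (before p)))

  objective-abel : ∀ {xs} → Fresh ∅ xs →
    objective u c xs ≡ ∑[ p ← steps ∅ xs ] (price p * (u (covered ∅ xs) - u (before p)))
  objective-abel {xs} fresh = begin
    objective u c xs               ≡⟨ objFrom-abel ∅ xs fresh ⟩
    costOf c ∅ * (U - u ∅) + rest  ≡⟨ cong (λ C → C * (U - u ∅) + rest) (costOf-∅ c) ⟩
    0ℚ * (U - u ∅) + rest          ≡⟨ cong (_+ rest) (ℚ.*-zeroˡ (U - u ∅)) ⟩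
    0ℚ + rest                      ≡⟨ ℚ.+-identityˡ rest ⟩
    rest                           ∎
    where
    open ≡-Reasoning
    U    = u (covered ∅ xs)
    rest = ∑[ p ← steps ∅ xs ] (price p * (U - u (before p)))

  objFrom-move-to-front : ∀ S e W → Fresh S W → e ∉ covered S W →
    objFrom u c S (e ∷ W) + ∑[ p ← steps S W ] (price p * marg u e (before p))
      ≡ objFrom u c S (W ++ [ e ]) + c e * (u (covered S W) - u S)
  objFrom-move-to-front S e []      _             _  =
    solve 3 (λ O k a → O :+ con 0ℚ := O :+ k :* (a :- a)) refl (objFrom u c S [ e ]) (c e) (u S)
  objFrom-move-to-front S e (w ∷ W) (w∉S , fresh) e∉ rewrite ∪⁅⁆-swap {S = S} e w =
    move-to-front-step (costOf c S) (c e) (c w) (u S) (u (S ∪ ⁅ e ⁆)) (u (S ∪ ⁅ w ⁆)) (u ((S ∪ ⁅ w ⁆) ∪ ⁅ e ⁆))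
      (objFrom u c ((S ∪ ⁅ w ⁆) ∪ ⁅ e ⁆) W) (∑[ p ← steps (S ∪ ⁅ w ⁆) W ] (price p * marg u e (before p)))
      (objFrom u c (S ∪ ⁅ w ⁆) (W ++ [ e ])) (u (covered (S ∪ ⁅ w ⁆) W))
      (costOf-∪⁅⁆ c e∉S) (costOf-∪⁅⁆ c w∉S) (costOf-∪⁅⁆ c e∉S∪w)
      (objFrom-move-to-front (S ∪ ⁅ w ⁆) e W fresh e∉)
    where
    e∉S∪w : e ∉ S ∪ ⁅ w ⁆
    e∉S∪w = e∉ ∘ ⊆-covered (S ∪ ⁅ w ⁆) W
    e∉S : e ∉ S
    e∉S = e∉S∪w ∘ p⊆p∪q ⁅ w ⁆

  LocalOptimum⇒move-earlier-≥ : ∀ P W e Q → LocalOptimum u c (P ++ (W ++ [ e ]) ++ Q) →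
    objFrom u c (covered ∅ P) (W ++ [ e ]) ≤ objFrom u c (covered ∅ P) (e ∷ W)
  LocalOptimum⇒move-earlier-≥ P W e Q lo =
    let i , j , moved = move-earlier P W e Q in
    +-cancelˡ-≤ (objFrom u c ∅ P) (+-cancelʳ-≤ (objFrom u c (covered S (W ++ [ e ])) Q) (begin
      objFrom u c ∅ P + objFrom u c S (W ++ [ e ]) + objFrom u c (covered S (W ++ [ e ])) Q
        ≡⟨ sym (objFrom-segment ∅ P (W ++ [ e ]) Q) ⟩
      objective u c (P ++ (W ++ [ e ]) ++ Q)
        ≤⟨ lo i j ⟩
      objective u c (move (P ++ (W ++ [ e ]) ++ Q) i j)
        ≡⟨ cong (objective u c) moved ⟩
      objective u c (P ++ (e ∷ W) ++ Q)
        ≡⟨ objFrom-segment ∅ P (e ∷ W) Q ⟩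
      objFrom u c ∅ P + objFrom u c S (e ∷ W) + objFrom u c (covered S (e ∷ W)) Q
        ≡⟨ cong (λ T → objFrom u c ∅ P + objFrom u c S (e ∷ W) + objFrom u c T Q) same-cover ⟩
      objFrom u c ∅ P + objFrom u c S (e ∷ W) + objFrom u c (covered S (W ++ [ e ])) Q
        ∎))
    where
    open ℚ.≤-Reasoning
    S = covered ∅ P
    same-cover : covered S (e ∷ W) ≡ covered S (W ++ [ e ])
    same-cover = trans (covered-∪⁅⁆ S e W) (sym (covered-++ S W [ e ]))

  -- By objFrom-move-to-front, for e ∉ covered S xs this says that moving e in
  -- front of xs does not lower the objective.
  ExchangeBounded : Fin n → Subset n → List (Fin n) → Set
  ExchangeBounded e S xs =
    ∑[ p ← steps S xs ] (price p * marg u e (before p)) ≤ c e * (u (covered S xs) - u S)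

  ExchangeBounded-++ : ∀ {e S} xs {ys} →
    ExchangeBounded e S xs → ExchangeBounded e (covered S xs) ys → ExchangeBounded e S (xs ++ ys)
  ExchangeBounded-++ {e} {S} xs {ys} bound₁ bound₂ = begin
    ∑ (steps S (xs ++ ys)) weighted
      ≡⟨ ∑-steps-++ S xs ys weighted ⟩
    ∑ (steps S xs) weighted + ∑ (steps T ys) weighted
      ≤⟨ ℚ.+-mono-≤ bound₁ bound₂ ⟩
    c e * (u T - u S) + c e * (u (covered T ys) - u T)
      ≡⟨ sym (ℚ.*-distribˡ-+ (c e) _ _) ⟩
    c e * ((u T - u S) + (u (covered T ys) - u T))
      ≡⟨ cong (c e *_) (difference-telescope (u S) (u T) (u (covered T ys))) ⟩
    c e * (u (covered T ys) - u S)
      ≡⟨ cong (λ V → c e * (u V - u S)) (sym (covered-++ S xs ys)) ⟩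
    c e * (u (covered S (xs ++ ys)) - u S)
      ∎
    where
    open ℚ.≤-Reasoning
    T = covered S xs
    weighted = λ p → price p * marg u e (before p)

  LocalOptimum⇒ExchangeBounded : ∀ P W e Q → let xs = P ++ (W ++ [ e ]) ++ Q in
    Fresh ∅ xs → LocalOptimum u c xs → ExchangeBounded e (covered ∅ P) W
  LocalOptimum⇒ExchangeBounded P W e Q fresh lo =
    let S                    = covered ∅ P
        _ , fresh-W[e]Q      = Fresh-++⁻ ∅ P fresh
        fresh-W[e] , _       = Fresh-++⁻ S (W ++ [ e ]) fresh-W[e]Q
        fresh-W , e∉ , _     = Fresh-++⁻ S W fresh-W[e]
    in  +-cancelˡ-≤ (objFrom u c S (e ∷ W)) (begin
    objFrom u c S (e ∷ W) + ∑[ p ← steps S W ] (price p * marg u e (before p))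
      ≡⟨ objFrom-move-to-front S e W fresh-W e∉ ⟩
    objFrom u c S (W ++ [ e ]) + c e * (u (covered S W) - u S)
      ≤⟨ ℚ.+-monoˡ-≤ _ (LocalOptimum⇒move-earlier-≥ P W e Q lo) ⟩
    objFrom u c S (e ∷ W) + c e * (u (covered S W) - u S)
      ∎)
    where open ℚ.≤-Reasoning

module Bounds {u : SetFn n} {c : Fin n → ℚ} (c≥0 : ∀ i → 0ℚ ≤ c i) (mono : Monotone u) where
  open Objective u c

  gain≥0 : ∀ p → 0ℚ ≤ gain p
  gain≥0 p = p≤q⇒0≤q-p (mono (before p) (after p) (p⊆p∪q ⁅ item p ⁆))

  cost≥0 : ∀ p → 0ℚ ≤ cost p
  cost≥0 p = subst₂ _≤_ (costOf-∅ c) (cong (costOf c) (∪-identityˡ (after p))) (costOf-∪-≥ c≥0 ∅ (after p))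

  steps-cost-≥ : ∀ S xs → All (λ p → costOf c S ≤ cost p) (steps S xs)
  steps-cost-≥ S []       = []
  steps-cost-≥ S (x ∷ xs) = S≤S∪x ∷ All.map (ℚ.≤-trans S≤S∪x) (steps-cost-≥ (S ∪ ⁅ x ⁆) xs)
    where S≤S∪x = costOf-∪-≥ c≥0 S ⁅ x ⁆

  threshold-suffix : ∀ θ S xs → ∃₂ λ P Q → xs ≡ P ++ Q ×
    (∀ f → ∑[ p ← steps S xs ] when (θ ≤? cost p) (f p) ≡ ∑ (steps (covered S P) Q) f)
  threshold-suffix θ S []       = [] , [] , refl , λ _ → refl
  threshold-suffix θ S (x ∷ xs) with θ ≤? costOf c (S ∪ ⁅ x ⁆)
  ... | yes θ≤ = [] , x ∷ xs , refl , λ f → cong (f (step S x) +_)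
    (∑-when-all (λ p → θ ≤? cost p) f (All.map (ℚ.≤-trans θ≤) (steps-cost-≥ (S ∪ ⁅ x ⁆) xs)))
  ... | no _   =
    let P , Q , xs≡ , restrict = threshold-suffix θ (S ∪ ⁅ x ⁆) xs
    in  x ∷ P , Q , cong (x ∷_) xs≡ , λ f → trans (ℚ.+-identityˡ _) (restrict f)

  -- Prefix costs grow along the steps, so the steps whose cost satisfies the
  -- downward-closed R form a prefix, and their prices add up to its cost.
  prefix-price-bound : ∀ {R Q : ℚ → Set} (R? : Decidable R) → R Respects _≥_ → (∀ {x} → R x → Q x) →
    ∀ S xs → Fresh S xs → Q (costOf c S) → Q (costOf c S + ∑[ p ← steps S xs ] when (R? (cost p)) (price p))
  prefix-price-bound {Q = Q} R? R-down R⇒Q S []       _             QS = subst Q (sym (ℚ.+-identityʳ _)) QS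
  prefix-price-bound {Q = Q} R? R-down R⇒Q S (x ∷ xs) (x∉S , fresh) QS with R? (costOf c (S ∪ ⁅ x ⁆))
  ... | yes R[S∪x] = subst Q regroup (prefix-price-bound R? R-down R⇒Q (S ∪ ⁅ x ⁆) xs fresh (R⇒Q R[S∪x]))
    where
    rest = ∑[ p ← steps (S ∪ ⁅ x ⁆) xs ] when (R? (cost p)) (price p)
    regroup : costOf c (S ∪ ⁅ x ⁆) + rest ≡ costOf c S + (c x + rest)
    regroup = trans (cong (_+ rest) (costOf-∪⁅⁆ c x∉S)) (ℚ.+-assoc (costOf c S) (c x) rest)
  ... | no ¬R[S∪x] = subst Q (sym (trans (cong (costOf c S +_) rest≡0) (ℚ.+-identityʳ _))) QS
    where
    rest≡0 : 0ℚ + ∑[ p ← steps (S ∪ ⁅ x ⁆) xs ] when (R? (cost p)) (price p) ≡ 0ℚ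
    rest≡0 = trans (ℚ.+-identityˡ _) (∑-when-none (R? ∘ cost) price
      (All.map (λ S∪x≤p R[p] → ¬R[S∪x] (R-down S∪x≤p R[p])) (steps-cost-≥ (S ∪ ⁅ x ⁆) xs)))

  prefix-price-bound-∅ : ∀ {R Q : ℚ → Set} (R? : Decidable R) → R Respects _≥_ → (∀ {x} → R x → Q x) →
    ∀ {xs} → Fresh ∅ xs → Q 0ℚ → Q (∑[ p ← steps ∅ xs ] when (R? (cost p)) (price p))
  prefix-price-bound-∅ {Q = Q} R? R-down R⇒Q {xs} fresh Q0 =
    subst Q (trans (cong (_+ prices) (costOf-∅ c)) (ℚ.+-identityˡ prices))
      (prefix-price-bound R? R-down R⇒Q ∅ xs fresh (subst Q (sym (costOf-∅ c)) Q0))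
    where prices = ∑[ p ← steps ∅ xs ] when (R? (cost p)) (price p)

  ExchangeBounded-∈ : ∀ {e S} xs → e ∈ S → ExchangeBounded e S xs
  ExchangeBounded-∈ {e} {S} xs e∈S = begin
    ∑[ p ← steps S xs ] (price p * marg u e (before p))
      ≡⟨ ∑-marg-∈ xs e∈S ⟩
    0ℚ
      ≡⟨ sym (ℚ.*-zeroʳ (c e)) ⟩
    c e * 0ℚ
      ≤⟨ *-monoˡ-≤-0≤ (c≥0 e) (p≤q⇒0≤q-p (mono S _ (⊆-covered S xs))) ⟩
    c e * (u (covered S xs) - u S)
      ∎
    where open ℚ.≤-Reasoning

  ExchangeBounded-∷ : ∀ {e S} xs → ExchangeBounded e S (e ∷ xs)
  ExchangeBounded-∷ {e} {S} xs = ExchangeBounded-++ [ e ] {xs}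
    (ℚ.≤-reflexive (ℚ.+-identityʳ _)) (ExchangeBounded-∈ xs (q⊆p∪q S ⁅ e ⁆ (x∈⁅x⁆ e)))

  -- X grows by the items of the steps satisfying R, a prefix of the steps;
  -- submodularity keeps the marginals at X below those at A.
  coverage-bound : Submodular u → ∀ {R : ℚ → Set} (R? : Decidable R) → R Respects _≥_ →
    ∀ A T X xs → (∀ y → marg u y X ≤ marg u y A) → T ⊆ X →
    u (covered T xs) - u X ≤ ∑[ q ← steps T xs ] when (R? (cost q)) (marg u (item q) A)
                             + ∑[ q ← steps T xs ] when (¬? (R? (cost q))) (gain q)
  coverage-bound sub R? R-down A T X []       _   T⊆X =
    ℚ.≤-trans (p≤q⇒p-q≤0 (mono T X T⊆X)) (ℚ.≤-reflexive (sym (ℚ.+-identityˡ 0ℚ)))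
  coverage-bound sub {R} R? R-down A T X (y ∷ ys) X≼A T⊆X with R? (costOf c (T ∪ ⁅ y ⁆))
  ... | yes _ = begin
    u V - u X                           ≡⟨ sym (difference-telescope (u X) (u (X ∪ ⁅ y ⁆)) (u V)) ⟩
    marg u y X + (u V - u (X ∪ ⁅ y ⁆))  ≤⟨ ℚ.+-mono-≤ (X≼A y) (coverage-bound sub R? R-down A (T ∪ ⁅ y ⁆)
                                                                 (X ∪ ⁅ y ⁆) ys X∪y≼A (∪⁅⁆-mono y T⊆X)) ⟩
    marg u y A + (Σ₁ + Σ₂)              ≡⟨ sym (ℚ.+-assoc (marg u y A) Σ₁ Σ₂) ⟩
    (marg u y A + Σ₁) + Σ₂              ≡⟨ cong ((marg u y A + Σ₁) +_) (sym (ℚ.+-identityˡ Σ₂)) ⟩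
    (marg u y A + Σ₁) + (0ℚ + Σ₂)       ∎
    where
    open ℚ.≤-Reasoning
    V  = covered (T ∪ ⁅ y ⁆) ys
    Σ₁ = ∑[ q ← steps (T ∪ ⁅ y ⁆) ys ] when (R? (cost q)) (marg u (item q) A)
    Σ₂ = ∑[ q ← steps (T ∪ ⁅ y ⁆) ys ] when (¬? (R? (cost q))) (gain q)
    X∪y≼A : ∀ z → marg u z (X ∪ ⁅ y ⁆) ≤ marg u z A
    X∪y≼A z = ℚ.≤-trans (Submodular⇒marg-∪⁅⁆-≤ u sub X z y) (X≼A z)
  ... | no ¬R[T∪y] = begin
    u V - u X                                 ≤⟨ ℚ.+-monoʳ-≤ (u V) (ℚ.neg-antimono-≤ (mono T X T⊆X)) ⟩
    u V - u T                                 ≡⟨ sym (∑-gain T (y ∷ ys)) ⟩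
    g + ∑ (steps (T ∪ ⁅ y ⁆) ys) gain          ≡⟨ sym (ℚ.+-identityˡ _) ⟩
    0ℚ + (g + ∑ (steps (T ∪ ⁅ y ⁆) ys) gain)   ≡⟨ cong₂ (λ a b → a + (g + b)) (sym 0+Σ₁≡0) (sym Σ₂≡) ⟩
    (0ℚ + Σ₁) + (g + Σ₂)                      ∎
    where
    open ℚ.≤-Reasoning
    V  = covered (T ∪ ⁅ y ⁆) ys
    g  = gain (step T y)
    Σ₁ = ∑[ q ← steps (T ∪ ⁅ y ⁆) ys ] when (R? (cost q)) (marg u (item q) A)
    Σ₂ = ∑[ q ← steps (T ∪ ⁅ y ⁆) ys ] when (¬? (R? (cost q))) (gain q)
    later-¬R : All (λ q → ¬ R (cost q)) (steps (T ∪ ⁅ y ⁆) ys)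
    later-¬R = All.map (λ T∪y≤q R[q] → ¬R[T∪y] (R-down T∪y≤q R[q])) (steps-cost-≥ (T ∪ ⁅ y ⁆) ys)
    0+Σ₁≡0 : 0ℚ + Σ₁ ≡ 0ℚ
    0+Σ₁≡0 = trans (ℚ.+-identityˡ Σ₁) (∑-when-none (R? ∘ cost) (λ q → marg u (item q) A) later-¬R)
    Σ₂≡ : Σ₂ ≡ ∑ (steps (T ∪ ⁅ y ⁆) ys) gain
    Σ₂≡ = ∑-when-all (λ q → ¬? (R? (cost q))) gain later-¬R

module LocalOptimality {u : SetFn n} {c : Fin n → ℚ} (c≥0 : ∀ i → 0ℚ ≤ c i) (mono : Monotone u)
  {π : List (Fin n)} (π-fresh : Fresh ∅ π) (π-covers : ∀ e → e ∈ₗ π) (lo : LocalOptimum u c π) where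
  open Objective u c
  open Bounds c≥0 mono

  suffix-ExchangeBounded : ∀ P L → π ≡ P ++ L → ∀ e → ExchangeBounded e (covered ∅ P) L
  suffix-ExchangeBounded P L π≡ e with ∈-++⁻ P (subst (e ∈ₗ_) π≡ (π-covers e))
  ... | inj₁ e∈P = ExchangeBounded-∈ L (∈-covered ∅ e∈P)
  ... | inj₂ e∈L with ∈-∃++ e∈L
  ... | W , Q , refl = ExchangeBounded-++ W
    (LocalOptimum⇒ExchangeBounded P W e Q (subst (Fresh ∅) π≡′ π-fresh) (subst (LocalOptimum u c) π≡′ lo))
    (ExchangeBounded-∷ Q)
    where
    π≡′ : π ≡ P ++ (W ++ [ e ]) ++ Q
    π≡′ = trans π≡ (cong (P ++_) (sym (++-assoc W [ e ] Q)))

  threshold-exchange-bound : ∀ θ e →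
    ∑[ p ← steps ∅ π ] when (θ ≤? cost p) (price p * marg u e (before p))
      ≤ c e * ∑[ p ← steps ∅ π ] when (θ ≤? cost p) (gain p)
  threshold-exchange-bound θ e =
    let P , L , π≡ , restrict = threshold-suffix θ ∅ π
        S                     = covered ∅ P
    in begin
    ∑[ p ← steps ∅ π ] when (θ ≤? cost p) (price p * marg u e (before p))  ≡⟨ restrict _ ⟩
    ∑[ p ← steps S L ] (price p * marg u e (before p))                      ≤⟨ suffix-ExchangeBounded P L π≡ e ⟩
    c e * (u (covered S L) - u S)                                           ≡⟨ cong (c e *_) (sym (∑-gain S L)) ⟩
    c e * ∑ (steps S L) gain                                                ≡⟨ cong (c e *_) (sym (restrict gain)) ⟩
    c e * ∑[ p ← steps ∅ π ] when (θ ≤? cost p) (gain p)                    ∎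
    where open ℚ.≤-Reasoning

module Approximation {u : SetFn n} {c : Fin n → ℚ} (c≥0 : ∀ i → 0ℚ ≤ c i) (mono : Monotone u)
  (sub : Submodular u) {π σ : List (Fin n)} (π-perm : IsPermutation π) (σ-perm : IsPermutation σ)
  (lo : LocalOptimum u c π) where
  open Objective u c
  open Bounds c≥0 mono
  open LocalOptimality c≥0 mono (IsPermutation⇒Fresh π-perm) (IsPermutation⇒∈ π-perm) lo

  ALG OPT : ℚ
  ALG = objective u c π
  OPT = objective u c σ

  _≪?_ : ∀ q p → Dec (cost q + cost q ≤ cost p)
  q ≪? p = cost q + cost q ≤? cost p

  cheap-part costly-part : ℚ
  cheap-part  = ∑[ p ← steps ∅ π ] (price p * ∑[ q ← steps ∅ σ ] when (q ≪? p) (marg u (item q) (before p)))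
  costly-part = ∑[ p ← steps ∅ π ] (price p * ∑[ q ← steps ∅ σ ] when (¬? (q ≪? p)) (gain q))

  σ-cheap-price π-costly-price : Step n → ℚ
  σ-cheap-price  p = ∑[ q ← steps ∅ σ ] when (q ≪? p) (price q)
  π-costly-price q = ∑[ p ← steps ∅ π ] when (¬? (q ≪? p)) (price p)

  σ-cheap-price-bound : ∀ p → σ-cheap-price p + σ-cheap-price p ≤ cost p
  σ-cheap-price-bound p = prefix-price-bound-∅ (λ x → x + x ≤? cost p) (double-≤-respects-≥ (cost p)) id
    (IsPermutation⇒Fresh σ-perm) (subst (_≤ cost p) (sym (ℚ.+-identityˡ 0ℚ)) (cost≥0 p))

  π-costly-price-bound : ∀ q → π-costly-price q ≤ cost q + cost q
  π-costly-price-bound q =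
    prefix-price-bound-∅ (λ x → ¬? (cost q + cost q ≤? x)) (≰-respects-≥ (cost q + cost q)) (ℚ.<⇒≤ ∘ ℚ.≰⇒>)
      (IsPermutation⇒Fresh π-perm) (ℚ.+-mono-≤ (cost≥0 q) (cost≥0 q))

  uncovered-bound : ∀ p →
    u (covered ∅ π) - u (before p) ≤ ∑[ q ← steps ∅ σ ] when (q ≪? p) (marg u (item q) (before p))
                                     + ∑[ q ← steps ∅ σ ] when (¬? (q ≪? p)) (gain q)
  uncovered-bound p = subst (λ V → u V - u (before p) ≤ _) same-cover
    (coverage-bound sub (λ x → x + x ≤? cost p) (double-≤-respects-≥ (cost p))
                    (before p) ∅ (before p) σ (λ _ → ℚ.≤-refl) (⊆-min (before p)))
    where
    same-cover : covered ∅ σ ≡ covered ∅ π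
    same-cover = trans (covered-⊤ (IsPermutation⇒∈ σ-perm)) (sym (covered-⊤ (IsPermutation⇒∈ π-perm)))

  ALG≤cheap+costly : ALG ≤ cheap-part + costly-part
  ALG≤cheap+costly = begin
    ALG
      ≡⟨ objective-abel (IsPermutation⇒Fresh π-perm) ⟩
    ∑[ p ← steps ∅ π ] (price p * (u (covered ∅ π) - u (before p)))
      ≤⟨ ∑-mono-≤ (steps ∅ π) (λ p → *-monoˡ-≤-0≤ (c≥0 (item p)) (uncovered-bound p)) ⟩
    ∑[ p ← steps ∅ π ] (price p * (cheap p + costly p))
      ≡⟨ ∑-cong (steps ∅ π) (λ p → ℚ.*-distribˡ-+ (price p) (cheap p) (costly p)) ⟩
    ∑[ p ← steps ∅ π ] (price p * cheap p + price p * costly p)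
      ≡⟨ ∑-distrib-+ (steps ∅ π) (λ p → price p * cheap p) (λ p → price p * costly p) ⟩
    cheap-part + costly-part
      ∎
    where
    open ℚ.≤-Reasoning
    cheap costly : Step n → ℚ
    cheap  p = ∑[ q ← steps ∅ σ ] when (q ≪? p) (marg u (item q) (before p))
    costly p = ∑[ q ← steps ∅ σ ] when (¬? (q ≪? p)) (gain q)

  cheap-part≤∑gain*σ-cheap-price : cheap-part ≤ ∑[ p ← steps ∅ π ] (gain p * σ-cheap-price p)
  cheap-part≤∑gain*σ-cheap-price = begin
    cheap-part
      ≡⟨ ∑-*-∑-when (λ p q → q ≪? p) (steps ∅ π) (steps ∅ σ) price (λ p q → marg u (item q) (before p)) ⟩
    ∑[ q ← steps ∅ σ ] ∑[ p ← steps ∅ π ] when (q ≪? p) (price p * marg u (item q) (before p))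
      ≤⟨ ∑-mono-≤ (steps ∅ σ) (λ q → threshold-exchange-bound (cost q + cost q) (item q)) ⟩
    ∑[ q ← steps ∅ σ ] (price q * ∑[ p ← steps ∅ π ] when (q ≪? p) (gain p))
      ≡⟨ ∑-*-∑-when-comm (λ q p → q ≪? p) (steps ∅ σ) (steps ∅ π) price gain ⟩
    ∑[ p ← steps ∅ π ] (gain p * σ-cheap-price p)
      ∎
    where open ℚ.≤-Reasoning

  cheap+cheap≤ALG : cheap-part + cheap-part ≤ ALG
  cheap+cheap≤ALG = begin
    cheap-part + cheap-part
      ≤⟨ ℚ.+-mono-≤ cheap-part≤∑gain*σ-cheap-price cheap-part≤∑gain*σ-cheap-price ⟩
    ∑[ p ← steps ∅ π ] (gain p * σ-cheap-price p) + ∑[ p ← steps ∅ π ] (gain p * σ-cheap-price p)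
      ≡⟨ sym (∑-distrib-+ (steps ∅ π) _ _) ⟩
    ∑[ p ← steps ∅ π ] (gain p * σ-cheap-price p + gain p * σ-cheap-price p)
      ≡⟨ ∑-cong (steps ∅ π) (λ p → sym (ℚ.*-distribˡ-+ (gain p) (σ-cheap-price p) (σ-cheap-price p))) ⟩
    ∑[ p ← steps ∅ π ] (gain p * (σ-cheap-price p + σ-cheap-price p))
      ≤⟨ ∑-mono-≤ (steps ∅ π) (λ p → *-monoˡ-≤-0≤ (gain≥0 p) (σ-cheap-price-bound p)) ⟩
    ∑[ p ← steps ∅ π ] (gain p * cost p)
      ≡⟨ ∑-cong (steps ∅ π) (λ p → ℚ.*-comm (gain p) (cost p)) ⟩
    ∑[ p ← steps ∅ π ] (cost p * gain p)
      ≡⟨ sym (objFrom≡∑ ∅ π) ⟩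
    ALG
      ∎
    where open ℚ.≤-Reasoning

  costly≤OPT+OPT : costly-part ≤ OPT + OPT
  costly≤OPT+OPT = begin
    costly-part
      ≡⟨ ∑-*-∑-when-comm (λ p q → ¬? (q ≪? p)) (steps ∅ π) (steps ∅ σ) price gain ⟩
    ∑[ q ← steps ∅ σ ] (gain q * π-costly-price q)
      ≤⟨ ∑-mono-≤ (steps ∅ σ) (λ q → *-monoˡ-≤-0≤ (gain≥0 q) (π-costly-price-bound q)) ⟩
    ∑[ q ← steps ∅ σ ] (gain q * (cost q + cost q))
      ≡⟨ ∑-cong (steps ∅ σ) (λ q → trans (ℚ.*-comm (gain q) _) (ℚ.*-distribʳ-+ (gain q) (cost q) (cost q))) ⟩
    ∑[ q ← steps ∅ σ ] (cost q * gain q + cost q * gain q)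
      ≡⟨ ∑-distrib-+ (steps ∅ σ) _ _ ⟩
    ∑[ q ← steps ∅ σ ] (cost q * gain q) + ∑[ q ← steps ∅ σ ] (cost q * gain q)
      ≡⟨ sym (cong₂ _+_ (objFrom≡∑ ∅ σ) (objFrom≡∑ ∅ σ)) ⟩
    OPT + OPT
      ∎
    where open ℚ.≤-Reasoning

theorem1 : (n : ℕ) → .{{_ : NonZero n}} →
    (u : SetFn n) → (c : Fin n → ℚ) →
    Normalized u → NonNegative u → Monotone u →
    Submodular u → SecondOrderSupermodular u →
    PositiveCosts c →
    (π : List (Fin n)) → IsPermutation π → LocalOptimum u c π →
    (σ : List (Fin n)) → IsPermutation σ →
    objective u c π ≤ 4ℚ * objective u c σ
theorem1 n u c _ _ mono sub _ c>0 π π-perm lo σ σ-perm =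
  a≤b+c⇒b+b≤a⇒c≤d+d⇒a≤4d {b = cheap-part} {d = OPT} ALG≤cheap+costly cheap+cheap≤ALG costly≤OPT+OPT
  where open Approximation (λ i → ℚ.<⇒≤ (c>0 i)) mono sub π-perm σ-perm lo
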